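{- Let $D=(E,\mathcal{F})$ be a set system and let $a,b\in E$ be distinct. Then $|\mathcal{F}|+|\widetilde{\mathcal{F}'}_{ab}|-|\mathcal{F}'_{ab}|-|\widetilde{\mathcal{F}}_{ab}|=0$.
   Context: A set system $D=(E,\mathcal{F})$ is a finite set $E$ with a collection $\mathcal{F}$ of subsets of $E$ (feasible sets). $\triangle$ denotes symmetric difference. For distinct $a,b\in E$ define: $\widetilde{\mathcal{F}}_{ab}=\mathcal{F}\triangle\{F\cup\{a\} : F\cup\{b\}\in\mathcal{F},\ F\subseteq E\setminus\{a,b\}\}$ (handle sliding $a$ over $b$); $\mathcal{F}'_{ab}=\mathcal{F}\triangle\{F\cup\{a,b\} : F\in\mathcal{F},\ F\subseteq E\setminus\{a,b\}\}$ (exchanging handle ends of $a$ and $b$); $\widetilde{\mathcal{F}'}_{ab}=\mathcal{F}\triangle\{F\cup\{a,b\} : F\in\mathcal{F},\ F\subseteq E\setminus\{a,b\}\}\triangle\{F\cup\{a\} : F\cup\{b\}\in\mathcal{F},\ F\subseteq E\setminus\{a,b\}\}$. -}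

module Defs where

open import Data.Nat using (ℕ; zero; suc; _+_)
open import Data.Bool using (Bool; true; false; _∧_; not; _xor_; if_then_else_)
open import Data.Fin using (Fin)
open import Data.Vec using (Vec; []; _∷_; lookup; _[_]≔_)
open import Data.List using (List; []; _∷_; map; _++_; length; filter)
open import Data.Fin.Subset using (Subset; inside; outside)

SetSystem : ℕ → Set
SetSystem n = Subset n → Bool

allSubsets : (n : ℕ) → List (Subset n)
allSubsets zero = [] ∷ []
allSubsets (suc n) = map (inside ∷_) (allSubsets n) ++ map (outside ∷_) (allSubsets n)

card : {n : ℕ} → SetSystem n → ℕ
card {n} 𝓕 = length (filter (λ X → Data.Bool._≟_ (𝓕 X) true) (allSubsets n))

_△_ : {n : ℕ} → SetSystem n → SetSystem n → SetSystem n
(𝓕 △ 𝓖) X = 𝓕 X xor 𝓖 X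

-- { F ∪ {a} : F ∪ {b} ∈ 𝓕, F ⊆ E ∖ {a,b} }
-- X is of this form iff a ∈ X, b ∉ X, and (X ∖ {a}) ∪ {b} ∈ 𝓕.
slideSet : {n : ℕ} → SetSystem n → Fin n → Fin n → SetSystem n
slideSet 𝓕 a b X =
  lookup X a ∧ not (lookup X b) ∧ 𝓕 ((X [ a ]≔ outside) [ b ]≔ inside)

-- { F ∪ {a,b} : F ∈ 𝓕, F ⊆ E ∖ {a,b} }
-- X is of this form iff a ∈ X, b ∈ X, and X ∖ {a,b} ∈ 𝓕.
pairSet : {n : ℕ} → SetSystem n → Fin n → Fin n → SetSystem n
pairSet 𝓕 a b X =
  lookup X a ∧ lookup X b ∧ 𝓕 ((X [ a ]≔ outside) [ b ]≔ outside)

slide : {n : ℕ} → SetSystem n → Fin n → Fin n → SetSystem n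
slide 𝓕 a b = 𝓕 △ slideSet 𝓕 a b

exchange : {n : ℕ} → SetSystem n → Fin n → Fin n → SetSystem n
exchange 𝓕 a b = 𝓕 △ pairSet 𝓕 a b

slideExchange : {n : ℕ} → SetSystem n → Fin n → Fin n → SetSystem n
slideExchange 𝓕 a b = (𝓕 △ pairSet 𝓕 a b) △ slideSet 𝓕 a b

{-# OPTIONS --safe #-}
module Submission where

-- Write P and S for pairSet 𝓕 a b and slideSet 𝓕 a b, so that 𝓕'_ab = 𝓕 △ P,
-- 𝓕~_ab = 𝓕 △ S and 𝓕~'_ab = 𝓕 △ P △ S. Every member of P contains b and no
-- member of S does, so P and S are disjoint, and for disjoint P, S the indicator
-- identity 1_𝓕 + 1_(𝓕△P△S) = 1_(𝓕△P) + 1_(𝓕△S) holds pointwise (check the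
-- three cases X ∉ P ∪ S, X ∈ P, X ∈ S). Summing over all subsets of E gives
-- |𝓕| + |𝓕~'_ab| = |𝓕'_ab| + |𝓕~_ab|.

open import Defs
open import Data.Bool using (Bool; true; false; _∧_; _xor_; _≟_)
open import Data.Bool.Properties using (∧-zeroʳ)
open import Data.Fin using (Fin)
open import Data.Fin.Subset using (Subset)
open import Data.Integer using (+_; _+_; _-_; -_; 0ℤ)
open import Data.Integer.Properties using (+-assoc; neg-distrib-+; i≡j⇒i-j≡0)
open import Data.List using (List; []; _∷_; length; filter)
open import Data.Nat using (ℕ)
import Data.Nat as ℕ
open import Data.Nat.Properties using (+-commutativeSemigroup)
open import Algebra.Properties.CommutativeSemigroup +-commutativeSemigroup using (interchange)
open import Data.Vec using (lookup)
open import Relation.Binary.PropositionalEquality using (_≡_; _≢_; refl; cong; cong₂; module ≡-Reasoning)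

open ≡-Reasoning

indicator : Bool → ℕ
indicator true  = 1
indicator false = 0

indicator-xor-disjoint : ∀ x p s → p ∧ s ≡ false →
  indicator x ℕ.+ indicator ((x xor p) xor s) ≡ indicator (x xor p) ℕ.+ indicator (x xor s)
indicator-xor-disjoint false false false _ = refl
indicator-xor-disjoint false false true  _ = refl
indicator-xor-disjoint false true  false _ = refl
indicator-xor-disjoint true  false false _ = refl
indicator-xor-disjoint true  false true  _ = refl
indicator-xor-disjoint true  true  false _ = refl

count : {A : Set} → (A → Bool) → List A → ℕ
count f xs = length (filter (λ x → f x ≟ true) xs)

count-∷ : {A : Set} (f : A → Bool) (x : A) (xs : List A) →
  count f (x ∷ xs) ≡ indicator (f x) ℕ.+ count f xs
count-∷ f x xs with f x
... | true  = refl
... | false = refl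

count-xor-disjoint : {A : Set} (f p s : A → Bool) → (∀ x → p x ∧ s x ≡ false) → (xs : List A) →
  count f xs ℕ.+ count (λ x → (f x xor p x) xor s x) xs
    ≡ count (λ x → f x xor p x) xs ℕ.+ count (λ x → f x xor s x) xs
count-xor-disjoint f p s disjoint [] = refl
count-xor-disjoint {A} f p s disjoint (x ∷ xs) = begin
  count f (x ∷ xs) ℕ.+ count f△p△s (x ∷ xs)
    ≡⟨ cong₂ ℕ._+_ (count-∷ f x xs) (count-∷ f△p△s x xs) ⟩
  (indicator (f x) ℕ.+ count f xs) ℕ.+ (indicator (f△p△s x) ℕ.+ count f△p△s xs)
    ≡⟨ interchange (indicator (f x)) (count f xs) (indicator (f△p△s x)) (count f△p△s xs) ⟩
  (indicator (f x) ℕ.+ indicator (f△p△s x)) ℕ.+ (count f xs ℕ.+ count f△p△s xs)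
    ≡⟨ cong₂ ℕ._+_ (indicator-xor-disjoint (f x) (p x) (s x) (disjoint x))
                   (count-xor-disjoint f p s disjoint xs) ⟩
  (indicator (f△p x) ℕ.+ indicator (f△s x)) ℕ.+ (count f△p xs ℕ.+ count f△s xs)
    ≡⟨ interchange (indicator (f△p x)) (indicator (f△s x)) (count f△p xs) (count f△s xs) ⟩
  (indicator (f△p x) ℕ.+ count f△p xs) ℕ.+ (indicator (f△s x) ℕ.+ count f△s xs)
    ≡⟨ cong₂ ℕ._+_ (count-∷ f△p x xs) (count-∷ f△s x xs) ⟨
  count f△p (x ∷ xs) ℕ.+ count f△s (x ∷ xs) ∎
  where
  f△p f△s f△p△s : A → Bool
  f△p   y = f y xor p y
  f△s   y = f y xor s y
  f△p△s y = (f y xor p y) xor s y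

pairSet-slideSet-disjoint : {n : ℕ} (𝓕 : SetSystem n) (a b : Fin n) (X : Subset n) →
  pairSet 𝓕 a b X ∧ slideSet 𝓕 a b X ≡ false
pairSet-slideSet-disjoint 𝓕 a b X with lookup X a | lookup X b
... | false | _     = refl
... | true  | true  = ∧-zeroʳ _
... | true  | false = refl

card-slideExchange : {n : ℕ} (𝓕 : SetSystem n) (a b : Fin n) →
  card 𝓕 ℕ.+ card (slideExchange 𝓕 a b) ≡ card (exchange 𝓕 a b) ℕ.+ card (slide 𝓕 a b)
card-slideExchange {n} 𝓕 a b =
  count-xor-disjoint 𝓕 (pairSet 𝓕 a b) (slideSet 𝓕 a b) (pairSet-slideSet-disjoint 𝓕 a b) (allSubsets n)

m+n≡o+p⇒m+n-o-p≡0 : ∀ m n o p → m ℕ.+ n ≡ o ℕ.+ p → + m + + n - + o - + p ≡ 0ℤ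
m+n≡o+p⇒m+n-o-p≡0 m n o p m+n≡o+p = begin
  + m + + n - + o - + p       ≡⟨ +-assoc (+ m + + n) (- + o) (- + p) ⟩
  + m + + n + (- + o - + p)   ≡⟨ cong (_+_ (+ m + + n)) (neg-distrib-+ (+ o) (+ p)) ⟨
  + m + + n - (+ o + + p)     ≡⟨ i≡j⇒i-j≡0 (cong +_ m+n≡o+p) ⟩
  0ℤ                          ∎

theorem3p7 : (n : ℕ) (𝓕 : SetSystem n) (a b : Fin n) → a ≢ b →
    (+ card 𝓕) + (+ card (slideExchange 𝓕 a b)) - (+ card (exchange 𝓕 a b)) - (+ card (slide 𝓕 a b)) ≡ 0ℤ
theorem3p7 n 𝓕 a b _ =
  m+n≡o+p⇒m+n-o-p≡0 (card 𝓕) (card (slideExchange 𝓕 a b)) (card (exchange 𝓕 a b)) (card (slide 𝓕 a b))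
    (card-slideExchange 𝓕 a b)
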